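{- Let $\alpha=(\alpha_1,\dots,\alpha_n)$ be a composition and suppose $1\le r\le n-1$ satisfies $\alpha_r<\alpha_{r+1}$. Let $w\in S_n$ be a permutation in which $r$ appears before $r+1$ (in one-line notation). Let $\alpha'=\alpha\cdot s_r$ (i.e. $\alpha$ with $\alpha_r,\alpha_{r+1}$ swapped). Then $x_\alpha(w)=x_{\alpha'}(w)$.
   Context: A composition is a vector of nonnegative integers. The skyline diagram $D(\gamma)$ of a composition $\gamma$ of length $n$ is the set of boxes $\{(i,j): 1\le i\le n,\ 1\le j\le\gamma_i\}$ (rows numbered top to bottom). For $w=w_1\cdots w_n\in S_n$, the filling $\mathcal{F}_w(D)$ of a diagram $D$ is defined column by column: for each column $j$, for $k=1,\dots,n$ in turn, place $w_k$ into the topmost still-empty box of $D$ in column $j$ whose row index is $\ge w_k$, skipping $w_k$ if no such box exists. For a composition $\gamma$, $x_\gamma(w)=(x_1,\dots,x_n)$ where $x_k$ is the total number of appearances of $k$ in $\mathcal{F}_w(D(\gamma))$ (these vectors are the vertex labels of the Newton polytope of the key polynomial $\kappa_\gamma$). -}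

module Defs where

open import Data.Nat using (ℕ; zero; suc; _≤ᵇ_; _⊔_)
open import Data.Bool using (Bool; true; false; if_then_else_)
open import Data.Fin using (Fin; toℕ; inject₁; _≟_)
open import Data.Fin.Permutation using (Permutation′; _⟨$⟩ʳ_; transpose)
open import Data.List using (List; []; _∷_; allFin; filterᵇ; length; concatMap; applyUpTo)
open import Data.Vec using (Vec; lookup; tabulate; foldr′)
open import Relation.Nullary using (does)
import Data.Product
import Data.List

-- Conventions: n is the length of the composition; rows 1..n and the values
-- 1..n of a permutation are represented by Fin n (0-based: row i ↔ Fin index i-1).
-- A permutation w ∈ S_n is a bijection Fin n ↔ Fin n; its one-line notation is
-- w_k = w ⟨$⟩ʳ k.

oneLine : ∀ {n} → Permutation′ n → List (Fin n)
oneLine {n} w = Data.List.map (w ⟨$⟩ʳ_) (allFin n)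

-- Rows of column j (1-based column index j) of the skyline diagram D(γ),
-- listed top to bottom: rows i with j ≤ γ_i.
columnRows : ∀ {n} → Vec ℕ n → ℕ → List (Fin n)
columnRows {n} γ j = filterᵇ (λ i → j ≤ᵇ lookup γ i) (allFin n)

-- Place value v in the topmost still-empty box (from the list of empty rows,
-- top to bottom) whose row index is ≥ v.
place : ∀ {n} → Fin n → List (Fin n) → Bool Data.Product.× List (Fin n)
place v [] = false Data.Product., []
place v (i ∷ is) with toℕ v ≤ᵇ toℕ i
... | true  = true Data.Product., is
... | false with place v is
...   | b Data.Product., is' = b Data.Product., (i ∷ is')

fillColumn : ∀ {n} → List (Fin n) → List (Fin n) → List (Fin n)
fillColumn empty [] = []
fillColumn empty (v ∷ vs) with place v empty
... | true  Data.Product., empty' = v ∷ fillColumn empty' vs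
... | false Data.Product., empty' = fillColumn empty' vs

maxPart : ∀ {n} → Vec ℕ n → ℕ
maxPart = foldr′ _⊔_ 0

filling : ∀ {n} → Vec ℕ n → Permutation′ n → List (Fin n)
filling γ w =
  concatMap (λ j → fillColumn (columnRows γ j) (oneLine w))
            (applyUpTo suc (maxPart γ))

xvec : ∀ {n} → Vec ℕ n → Permutation′ n → Vec ℕ n
xvec γ w = tabulate (λ k → length (filterᵇ (λ v → does (v ≟ k)) (filling γ w)))

swapAt : ∀ {n} → Vec ℕ n → Fin n → Fin n → Vec ℕ n
swapAt α i j = tabulate (λ k → lookup α (transpose i j ⟨$⟩ʳ k))

module Submission where

-- The swap keeps the number of columns, and a column of D(α) changes only
-- when α_r < j ≤ α_{r+1}; then the box in row r+1 moves up to row r, above which the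
-- column is unchanged.  A value v ≠ r+1 cannot tell these two boxes apart
-- (v ≤ r+1 iff v ≤ r), so the two fillings proceed in lockstep until the value r
-- arrives, which happens before r+1 arrives.  All boxes above row r reject r, so it
-- lands in the moved box in both columns, and from then on the empty boxes coincide.

open import Defs
open import Data.Nat using (ℕ; suc; _<_)
open import Data.Fin using (Fin; inject₁) renaming (_<_ to _<ᶠ_; suc to fsuc)
open import Data.Fin.Permutation using (Permutation′; _⟨$⟩ˡ_)
open import Data.Vec using (Vec; lookup)
open import Relation.Binary.PropositionalEquality using (_≡_)

open import Data.Bool using (Bool; true; false)
open import Data.Sum using (_⊎_; inj₁; inj₂)
open import Data.Fin using (zero; toℕ; _≟_)
open import Data.Fin.Properties using (toℕ-injective; toℕ-inject₁; suc-injective)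
import Data.Fin.Permutation.Components as PC
open import Data.Fin.Permutation using (_⟨$⟩ʳ_; inverseˡ; inverseʳ; transpose)
open import Data.List using (List; []; _∷_; filterᵇ; applyUpTo)
import Data.List as List
open import Data.List.Properties using (map-tabulate; concatMap-cong)
open import Data.List.Relation.Unary.All using (All; []; _∷_)
open import Data.List.Relation.Unary.All.Properties using (tabulate⁺)
open import Data.Nat using (_≤_; _≤ᵇ_; z≤n; s≤s; s≤s⁻¹)
open import Data.Nat.Properties
  using ( ≤ᵇ-reflects-≤; ≤ᵇ⇒≤; ≤⇒≤ᵇ; m≤n⇒m≤1+n; n≤1+n; ≤-refl; <⇒≱; ≤∧≢⇒<; ≤-trans
        ; ≤-antisym; <-asym; <⇒≤; ⊔-lub; m≤m⊔n; m≤n⊔m; ≰⇒>; _≤?_)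
open import Data.Product using (_×_; _,_)
open import Data.Vec using ([]; _∷_; tabulate)
open import Data.Vec.Properties using (lookup∘tabulate)
open import Function using (_∘_; id)
open import Relation.Nullary using (¬_; yes; no; does)
open import Relation.Nullary.Decidable using (dec-true; dec-false)
open import Relation.Nullary.Reflects using (det; ofʸ; ofⁿ; fromEquivalence)
open import Relation.Binary.PropositionalEquality using (refl; sym; trans; cong; subst; _≢_)

≤ᵇ-true : ∀ {m n} → m ≤ n → (m ≤ᵇ n) ≡ true
≤ᵇ-true {m} {n} m≤n = det (≤ᵇ-reflects-≤ m n) (ofʸ m≤n)

≤ᵇ-false : ∀ {m n} → ¬ m ≤ n → (m ≤ᵇ n) ≡ false
≤ᵇ-false {m} {n} m≰n = det (≤ᵇ-reflects-≤ m n) (ofⁿ m≰n)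

≤ᵇ-suc : ∀ {m n} → m ≢ suc n → (m ≤ᵇ suc n) ≡ (m ≤ᵇ n)
≤ᵇ-suc {m} {n} m≢1+n = det (≤ᵇ-reflects-≤ m (suc n))
  (fromEquivalence (m≤n⇒m≤1+n ∘ ≤ᵇ⇒≤ m n)
                   (λ m≤1+n → ≤⇒≤ᵇ (s≤s⁻¹ (≤∧≢⇒< m≤1+n m≢1+n))))

filterᵇ-cong : ∀ {A : Set} {P Q : A → Bool} {xs : List A}
  → All (λ x → P x ≡ Q x) xs → filterᵇ P xs ≡ filterᵇ Q xs
filterᵇ-cong [] = refl
filterᵇ-cong {P = P} {Q} {x ∷ xs} (Px≡Qx ∷ eqs) rewrite Px≡Qx with Q x
... | true  = cong (x ∷_) (filterᵇ-cong eqs)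
... | false = filterᵇ-cong eqs

module _ {N : ℕ} where

  data ShiftedUp (ρ : ℕ) : List (Fin N) → List (Fin N) → Set where
    here  : ∀ {x y} B → toℕ x ≡ suc ρ → toℕ y ≡ ρ → ShiftedUp ρ (x ∷ B) (y ∷ B)
    there : ∀ {a E₁ E₂} → toℕ a < ρ → ShiftedUp ρ E₁ E₂ → ShiftedUp ρ (a ∷ E₁) (a ∷ E₂)

  data PlaceRelated (ρ : ℕ) : Bool × List (Fin N) → Bool × List (Fin N) → Set where
    same    : ∀ p → PlaceRelated ρ p p
    shifted : ∀ b {E₁ E₂} → ShiftedUp ρ E₁ E₂ → PlaceRelated ρ (b , E₁) (b , E₂)

  place-ShiftedUp : ∀ {ρ E₁ E₂} (v : Fin N) → toℕ v ≢ suc ρ → ShiftedUp ρ E₁ E₂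
    → PlaceRelated ρ (place v E₁) (place v E₂)
  place-ShiftedUp v v≢1+ρ (here {x} {y} B x≡1+ρ y≡ρ)
    with toℕ v ≤ᵇ toℕ x | toℕ v ≤ᵇ toℕ y | rows-indistinguishable
    where
    rows-indistinguishable : (toℕ v ≤ᵇ toℕ x) ≡ (toℕ v ≤ᵇ toℕ y)
    rows-indistinguishable rewrite x≡1+ρ | y≡ρ = ≤ᵇ-suc v≢1+ρ
  ... | true  | _ | refl = same _
  ... | false | _ | refl with place v B
  ...   | b , B′ = shifted b (here B′ x≡1+ρ y≡ρ)
  place-ShiftedUp v v≢1+ρ (there {a} {E₁} {E₂} a<ρ E₁↑E₂) with toℕ v ≤ᵇ toℕ a
  ... | true  = shifted true E₁↑E₂
  ... | false with place v E₁ | place v E₂ | place-ShiftedUp v v≢1+ρ E₁↑E₂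
  ...   | _ | _ | same _ = same _
  ...   | _ | _ | shifted b E₁′↑E₂′ = shifted b (there a<ρ E₁′↑E₂′)

  place-ShiftedUp-ρ : ∀ {ρ E₁ E₂} (v : Fin N) → toℕ v ≡ ρ → ShiftedUp ρ E₁ E₂
    → place v E₁ ≡ place v E₂
  place-ShiftedUp-ρ v refl (here B x≡1+v y≡v)
    rewrite x≡1+v | y≡v | ≤ᵇ-true (n≤1+n (toℕ v)) | ≤ᵇ-true (≤-refl {toℕ v}) = refl
  place-ShiftedUp-ρ v refl (there {a} {E₁} {E₂} a<v E₁↑E₂)
    rewrite ≤ᵇ-false (<⇒≱ a<v)
    with place v E₁ | place v E₂ | place-ShiftedUp-ρ v refl E₁↑E₂
  ... | _ | _ | refl = refl

  data NoSuccBefore (ρ : ℕ) : List (Fin N) → Set where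
    []   : NoSuccBefore ρ []
    hit  : ∀ {v vs} → toℕ v ≡ ρ → NoSuccBefore ρ (v ∷ vs)
    skip : ∀ {v vs} → toℕ v ≢ suc ρ → NoSuccBefore ρ vs → NoSuccBefore ρ (v ∷ vs)

  fillColumn-ShiftedUp : ∀ {ρ E₁ E₂ vs} → ShiftedUp ρ E₁ E₂ → NoSuccBefore ρ vs
    → fillColumn E₁ vs ≡ fillColumn E₂ vs
  fillColumn-ShiftedUp E₁↑E₂ [] = refl
  fillColumn-ShiftedUp {vs = v ∷ _} E₁↑E₂ (hit v≡ρ)
    rewrite place-ShiftedUp-ρ v v≡ρ E₁↑E₂ = refl
  fillColumn-ShiftedUp {E₁ = E₁} {E₂} {v ∷ _} E₁↑E₂ (skip v≢1+ρ ok)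
    with place v E₁ | place v E₂ | place-ShiftedUp v v≢1+ρ E₁↑E₂
  ... | _ | _ | same (true , _)  = refl
  ... | _ | _ | same (false , _) = refl
  ... | _ | _ | shifted true E₁′↑E₂′  = cong (v ∷_) (fillColumn-ShiftedUp E₁′↑E₂′ ok)
  ... | _ | _ | shifted false E₁′↑E₂′ = fillColumn-ShiftedUp E₁′↑E₂′ ok

  noSuccBefore-tabulate : ∀ {ρ n} (h : Fin n → Fin N) (i : Fin n) → toℕ (h i) ≡ ρ
    → (∀ k → toℕ k < toℕ i → toℕ (h k) ≢ suc ρ) → NoSuccBefore ρ (List.tabulate h)
  noSuccBefore-tabulate h zero     hi≡ρ _ = hit hi≡ρ
  noSuccBefore-tabulate h (fsuc i) hi≡ρ earlier =
    skip (earlier zero (s≤s z≤n))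
         (noSuccBefore-tabulate (h ∘ fsuc) i hi≡ρ (λ k k<i → earlier (fsuc k) (s≤s k<i)))

  filterᵇ-tabulate-ShiftedUp : ∀ {ρ n} (g : Fin (suc n) → Fin N) (r : Fin n)
    {P₁ P₂ : Fin N → Bool}
    → (∀ k → toℕ k < toℕ r → toℕ (g k) < ρ)
    → toℕ (g (inject₁ r)) ≡ ρ → toℕ (g (fsuc r)) ≡ suc ρ
    → P₁ (g (inject₁ r)) ≡ false → P₁ (g (fsuc r)) ≡ true
    → P₂ (g (inject₁ r)) ≡ true  → P₂ (g (fsuc r)) ≡ false
    → (∀ k → k ≢ inject₁ r → k ≢ fsuc r → P₁ (g k) ≡ P₂ (g k))
    → ShiftedUp ρ (filterᵇ P₁ (List.tabulate g)) (filterᵇ P₂ (List.tabulate g))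
  filterᵇ-tabulate-ShiftedUp g zero _ g₀≡ρ g₁≡1+ρ P₁g₀ P₁g₁ P₂g₀ P₂g₁ agree
    rewrite P₁g₀ | P₁g₁ | P₂g₀ | P₂g₁
    = subst (ShiftedUp _ _ ∘ (g zero ∷_))
            (filterᵇ-cong (tabulate⁺ (λ k → agree (fsuc (fsuc k)) (λ ()) (λ ()))))
            (here _ g₁≡1+ρ g₀≡ρ)
  filterᵇ-tabulate-ShiftedUp g (fsuc r) {P₁} {P₂}
                             earlier g₀≡ρ g₁≡1+ρ P₁g₀ P₁g₁ P₂g₀ P₂g₁ agree
    rewrite agree zero (λ ()) (λ ())
    with P₂ (g zero)
       | filterᵇ-tabulate-ShiftedUp (g ∘ fsuc) r {P₁} {P₂} (λ k k<r → earlier (fsuc k) (s≤s k<r))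
           g₀≡ρ g₁≡1+ρ P₁g₀ P₁g₁ P₂g₀ P₂g₁
           (λ k k≢r k≢1+r → agree (fsuc k) (k≢r ∘ suc-injective) (k≢1+r ∘ suc-injective))
  ... | true  | rest = there (earlier zero (s≤s z≤n)) rest
  ... | false | rest = rest

transpose-matchˡ : ∀ {n} (i j : Fin n) → PC.transpose i j i ≡ j
transpose-matchˡ i j rewrite dec-true (i ≟ i) refl = refl

transpose-matchʳ : ∀ {n} (i j : Fin n) → PC.transpose i j j ≡ i
transpose-matchʳ i j with j ≟ i
... | yes j≡i = j≡i
... | no  _   rewrite dec-true (j ≟ j) refl = refl

transpose-mod : ∀ {n} {i j k : Fin n} → k ≢ i → k ≢ j → PC.transpose i j k ≡ k
transpose-mod {i = i} {j} {k} k≢i k≢j rewrite dec-false (k ≟ i) k≢i | dec-false (k ≟ j) k≢j = refl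

module _ {n : ℕ} (γ : Vec ℕ n) where

  lookup-swapAt : ∀ i j k → lookup (swapAt γ i j) k ≡ lookup γ (PC.transpose i j k)
  lookup-swapAt i j = lookup∘tabulate (λ k → lookup γ (transpose i j ⟨$⟩ʳ k))

  lookup-swapAtˡ : ∀ i j → lookup (swapAt γ i j) i ≡ lookup γ j
  lookup-swapAtˡ i j = trans (lookup-swapAt i j i) (cong (lookup γ) (transpose-matchˡ i j))

  lookup-swapAtʳ : ∀ i j → lookup (swapAt γ i j) j ≡ lookup γ i
  lookup-swapAtʳ i j = trans (lookup-swapAt i j j) (cong (lookup γ) (transpose-matchʳ i j))

  lookup-swapAt-mod : ∀ {i j k} → k ≢ i → k ≢ j → lookup (swapAt γ i j) k ≡ lookup γ k
  lookup-swapAt-mod {i} {j} {k} k≢i k≢j =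
    trans (lookup-swapAt i j k) (cong (lookup γ) (transpose-mod k≢i k≢j))

  columnRows-swapAt-agree : ∀ i i′ j → (j ≤ᵇ lookup γ i) ≡ (j ≤ᵇ lookup γ i′)
    → columnRows (swapAt γ i i′) j ≡ columnRows γ j
  columnRows-swapAt-agree i i′ j same-membership = filterᵇ-cong (tabulate⁺ agree)
    where
    agree : ∀ k → (j ≤ᵇ lookup (swapAt γ i i′) k) ≡ (j ≤ᵇ lookup γ k)
    agree k with k ≟ i | k ≟ i′
    ... | yes refl | _        rewrite lookup-swapAtˡ i i′ = sym same-membership
    ... | no _     | yes refl rewrite lookup-swapAtʳ i i′ = same-membership
    ... | no k≢i   | no k≢i′  rewrite lookup-swapAt-mod k≢i k≢i′ = refl

lookup≤maxPart : ∀ {n} (γ : Vec ℕ n) i → lookup γ i ≤ maxPart γ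
lookup≤maxPart (x ∷ γ) zero     = m≤m⊔n x (maxPart γ)
lookup≤maxPart (x ∷ γ) (fsuc i) = ≤-trans (lookup≤maxPart γ i) (m≤n⊔m x (maxPart γ))

maxPart-lub : ∀ {n} (γ : Vec ℕ n) {x} → (∀ i → lookup γ i ≤ x) → maxPart γ ≤ x
maxPart-lub []      _     = z≤n
maxPart-lub (_ ∷ γ) bound = ⊔-lub (bound zero) (maxPart-lub γ (bound ∘ fsuc))

maxPart-permute : ∀ {n} (γ : Vec ℕ n) (σ : Permutation′ n)
  → maxPart (tabulate (λ k → lookup γ (σ ⟨$⟩ʳ k))) ≡ maxPart γ
maxPart-permute {n} γ σ = ≤-antisym
  (maxPart-lub γσ λ k → subst (_≤ maxPart γ) (sym (lookup∘tabulate _ k)) (lookup≤maxPart γ _))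
  (maxPart-lub γ λ k → subst (_≤ maxPart γσ) (lookup-γσ-inverse k) (lookup≤maxPart γσ (σ ⟨$⟩ˡ k)))
  where
  γσ : Vec ℕ n
  γσ = tabulate (λ k → lookup γ (σ ⟨$⟩ʳ k))
  lookup-γσ-inverse : ∀ k → lookup γσ (σ ⟨$⟩ˡ k) ≡ lookup γ k
  lookup-γσ-inverse k = trans (lookup∘tabulate _ (σ ⟨$⟩ˡ k)) (cong (lookup γ) (inverseʳ σ))

module _ {m : ℕ} (α : Vec ℕ (suc m)) (r : Fin m) where

  private
    α′ : Vec ℕ (suc m)
    α′ = swapAt α (inject₁ r) (fsuc r)

  columnRows-swapAt-ShiftedUp : ∀ {j} → lookup α (inject₁ r) < j → j ≤ lookup α (fsuc r)
    → ShiftedUp (toℕ r) (columnRows α j) (columnRows α′ j)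
  columnRows-swapAt-ShiftedUp {j} αr<j j≤αr+1 =
    filterᵇ-tabulate-ShiftedUp id r (λ _ k<r → k<r) (toℕ-inject₁ r) refl
      (≤ᵇ-false (<⇒≱ αr<j))
      (≤ᵇ-true j≤αr+1)
      (trans (cong (j ≤ᵇ_) (lookup-swapAtˡ α (inject₁ r) (fsuc r))) (≤ᵇ-true j≤αr+1))
      (trans (cong (j ≤ᵇ_) (lookup-swapAtʳ α (inject₁ r) (fsuc r))) (≤ᵇ-false (<⇒≱ αr<j)))
      (λ k k≢r k≢r+1 → cong (j ≤ᵇ_) (sym (lookup-swapAt-mod α k≢r k≢r+1)))

  columnRows-swapAt : lookup α (inject₁ r) < lookup α (fsuc r)
    → ∀ j → columnRows α′ j ≡ columnRows α j ⊎ ShiftedUp (toℕ r) (columnRows α j) (columnRows α′ j)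
  columnRows-swapAt αr<αr+1 j with j ≤? lookup α (inject₁ r) | j ≤? lookup α (fsuc r)
  ... | yes j≤αr | _ = inj₁ (columnRows-swapAt-agree α (inject₁ r) (fsuc r) j
    (trans (≤ᵇ-true j≤αr) (sym (≤ᵇ-true (≤-trans j≤αr (<⇒≤ αr<αr+1))))))
  ... | no j≰αr | yes j≤αr+1 = inj₂ (columnRows-swapAt-ShiftedUp (≰⇒> j≰αr) j≤αr+1)
  ... | no j≰αr | no j≰αr+1 = inj₁ (columnRows-swapAt-agree α (inject₁ r) (fsuc r) j
    (trans (≤ᵇ-false j≰αr) (sym (≤ᵇ-false j≰αr+1))))

  fillColumn-swapAt : lookup α (inject₁ r) < lookup α (fsuc r)
    → ∀ {vs} → NoSuccBefore (toℕ r) vs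
    → ∀ j → fillColumn (columnRows α j) vs ≡ fillColumn (columnRows α′ j) vs
  fillColumn-swapAt αr<αr+1 {vs} ok j with columnRows-swapAt αr<αr+1 j
  ... | inj₁ unchanged = cong (λ E → fillColumn E vs) (sym unchanged)
  ... | inj₂ moved     = fillColumn-ShiftedUp moved ok

oneLine-NoSuccBefore : ∀ {m} (w : Permutation′ (suc m)) (r : Fin m)
  → (w ⟨$⟩ˡ inject₁ r) <ᶠ (w ⟨$⟩ˡ fsuc r) → NoSuccBefore (toℕ r) (oneLine w)
oneLine-NoSuccBefore w r r-before-r+1 =
  subst (NoSuccBefore (toℕ r)) (sym (map-tabulate id (w ⟨$⟩ʳ_)))
    (noSuccBefore-tabulate (w ⟨$⟩ʳ_) (w ⟨$⟩ˡ inject₁ r)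
      (trans (cong toℕ (inverseʳ w)) (toℕ-inject₁ r)) r+1-not-earlier)
  where
  r+1-not-earlier : ∀ k → toℕ k < toℕ (w ⟨$⟩ˡ inject₁ r) → toℕ (w ⟨$⟩ʳ k) ≢ suc (toℕ r)
  r+1-not-earlier k k<pos[r] wk≡r+1 =
    <-asym k<pos[r] (subst (λ p → w ⟨$⟩ˡ inject₁ r <ᶠ p) pos[r+1]≡k r-before-r+1)
    where
    pos[r+1]≡k : w ⟨$⟩ˡ fsuc r ≡ k
    pos[r+1]≡k = trans (cong (w ⟨$⟩ˡ_) (sym (toℕ-injective wk≡r+1))) (inverseˡ w)

filling-cong : ∀ {n} {γ δ : Vec ℕ n} (w : Permutation′ n) → maxPart γ ≡ maxPart δ
  → (∀ j → fillColumn (columnRows γ j) (oneLine w) ≡ fillColumn (columnRows δ j) (oneLine w))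
  → filling γ w ≡ filling δ w
filling-cong {δ = δ} w same-max same-columns rewrite same-max =
  concatMap-cong same-columns (applyUpTo suc (maxPart δ))

proposition4p5 : (m : ℕ) (α : Vec ℕ (suc m)) (r : Fin m)
    → lookup α (inject₁ r) < lookup α (fsuc r)
    → (w : Permutation′ (suc m))
    → (w ⟨$⟩ˡ inject₁ r) <ᶠ (w ⟨$⟩ˡ fsuc r)
    → xvec α w ≡ xvec (swapAt α (inject₁ r) (fsuc r)) w
proposition4p5 m α r αr<αr+1 w r-before-r+1 =
  cong (λ F → tabulate λ k → List.length (filterᵇ (λ v → does (v ≟ k)) F))
       (filling-cong {γ = α} w (sym (maxPart-permute α (transpose (inject₁ r) (fsuc r))))
                               (fillColumn-swapAt α r αr<αr+1 (oneLine-NoSuccBefore w r r-before-r+1)))
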